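{- For every finite simple graph $G$, $\tau(G)\le \rho(G)$. Consequently, for every positive integer $n$, $\tau(n)\le \rho(n)$.
   Context: The $d$-dimensional hypercube $Q_d$ has vertex set $\{0,1\}^d$. A subcube of $Q_d$ is a set of the form $\{x\in\{0,1\}^d : x_j=a_j \text{ for all } j\in J\}$ for some $J\subseteq\{1,\dots,d\}$ and constants $a_j\in\{0,1\}$; its dimension is $d-|J|$ (the number of free coordinates). The intersection graph of a family of sets has one vertex per set and an edge between two vertices iff the corresponding sets intersect. For a graph $G$, $\rho(G)$ is the least $d$ such that $G$ is (isomorphic to) the intersection graph of a family of subcubes of $Q_d$, and $\tau(G)$ is the least $r$ such that $G$ is the intersection graph of a family of subcubes, each of dimension exactly $r$, of some hypercube. For a positive integer $n$, $\rho(n)=\max\{\rho(G): G \text{ has } n \text{ vertices}\}$ and $\tau(n)=\max\{\tau(G): G \text{ has } n \text{ vertices}\}$. -}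

module Defs where

open import Data.Nat using (ℕ; zero; suc; _≤_)
open import Data.Fin using (Fin)
open import Data.Bool using (Bool)
open import Data.Maybe using (Maybe; just; nothing)
open import Data.Vec using (Vec; []; _∷_; lookup)
open import Data.Product using (Σ; _×_; ∃-syntax)
open import Relation.Binary.PropositionalEquality using (_≡_)
open import Relation.Nullary using (¬_)
open import Function.Bundles using (_⇔_)
open import Level using () renaming (suc to lsuc; zero to lzero)

record SimpleGraph (n : ℕ) : Set₁ where
  field
    Adj    : Fin n → Fin n → Set
    sym    : ∀ {u v} → Adj u v → Adj v u
    irrefl : ∀ {u} → ¬ Adj u u
open SimpleGraph public

Vertex : ℕ → Set
Vertex d = Vec Bool d

-- A subcube of Q_d given by its pattern: position j is 'just a' if j ∈ J
-- with x_j = a fixed, and 'nothing' if coordinate j is free.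
Subcube : ℕ → Set
Subcube d = Vec (Maybe Bool) d

_∈C_ : ∀ {d} → Vertex d → Subcube d → Set
_∈C_ {d} x C = ∀ (j : Fin d) (a : Bool) → lookup C j ≡ just a → lookup x j ≡ a

dim : ∀ {d} → Subcube d → ℕ
dim [] = zero
dim (nothing ∷ C) = suc (dim C)
dim (just _ ∷ C) = dim C

Intersect : ∀ {d} → Subcube d → Subcube d → Set
Intersect {d} C D = ∃[ x ] (x ∈C C × x ∈C D)

-- f realises G as the intersection graph of the family (f v)_v
-- (the vertex labelling is the graph isomorphism).
IsIntersectionRep : ∀ {n d} → SimpleGraph n → (Fin n → Subcube d) → Set
IsIntersectionRep {n} G f =
  ∀ (u v : Fin n) → ¬ (u ≡ v) → (Adj G u v ⇔ Intersect (f u) (f v))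

RhoRep : ∀ {n} → SimpleGraph n → ℕ → Set
RhoRep G d = ∃[ f ] IsIntersectionRep {d = d} G f

TauRep : ∀ {n} → SimpleGraph n → ℕ → Set
TauRep {n} G r = ∃[ D ] ∃[ f ] (IsIntersectionRep {d = D} G f × (∀ v → dim (f v) ≡ r))

-- ρ(G) ≤ d  (ρ(G) is the least d with RhoRep G d)
ρ≤ : ∀ {n} → SimpleGraph n → ℕ → Set
ρ≤ G d = ∃[ d' ] (d' ≤ d × RhoRep G d')

τ≤ : ∀ {n} → SimpleGraph n → ℕ → Set
τ≤ G r = ∃[ r' ] (r' ≤ r × TauRep G r')

-- ρ(n) ≤ d  (ρ(n) = max over n-vertex graphs)
ρn≤ : ℕ → ℕ → Set₁
ρn≤ n d = ∀ (G : SimpleGraph n) → ρ≤ G d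

τn≤ : ℕ → ℕ → Set₁
τn≤ n d = ∀ (G : SimpleGraph n) → τ≤ G d

-- Double every coordinate of Q_d. A fixed coordinate x_j = a becomes the pair
-- (a, free) and a free coordinate becomes the pair (free, 0), so every padded
-- subcube of Q_{2d} has dimension exactly d. Intersections are unchanged: a
-- common point of two subcubes lifts by setting every partner coordinate to 0,
-- and a common point of the padded cubes projects back onto the odd coordinates.
module Submission where

open import Defs
open import Data.Nat using (ℕ; _≤_; zero; suc)
open import Data.Nat.Properties using (≤-refl)
open import Data.Product using (_×_; _,_)
open import Data.Bool using (Bool; false)
open import Data.Maybe using (Maybe; just; nothing)
open import Data.Maybe.Properties using (just-injective)
open import Data.Vec using ([]; _∷_)
open import Data.Fin using (Fin)
open import Function.Base using (_∘_)
open import Relation.Binary.PropositionalEquality using (_≡_; refl; cong)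
open import Function.Bundles using (_⇔_; mk⇔; Equivalence)

double : ℕ → ℕ
double zero = zero
double (suc d) = suc (suc (double d))

Fits : Bool → Maybe Bool → Set
Fits b c = ∀ a → c ≡ just a → b ≡ a

∈C-head : ∀ {d b c} {x : Vertex d} {C : Subcube d} → (b ∷ x) ∈C (c ∷ C) → Fits b c
∈C-head h = h Fin.zero

∈C-tail : ∀ {d b c} (x : Vertex d) {C : Subcube d} → (b ∷ x) ∈C (c ∷ C) → x ∈C C
∈C-tail x h j = h (Fin.suc j)

∈C-∷ : ∀ {d b c} {x : Vertex d} {C : Subcube d} → Fits b c → x ∈C C → (b ∷ x) ∈C (c ∷ C)
∈C-∷ h t Fin.zero = h
∈C-∷ h t (Fin.suc j) = t j

fits-free : ∀ b → Fits b nothing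
fits-free b a ()

fits-fixed : ∀ a → Fits a (just a)
fits-fixed a _ = just-injective

pad : ∀ {d} → Subcube d → Subcube (double d)
pad [] = []
pad (nothing ∷ C) = nothing ∷ just false ∷ pad C
pad (just a ∷ C) = just a ∷ nothing ∷ pad C

padVertex : ∀ {d} → Vertex d → Vertex (double d)
padVertex [] = []
padVertex (b ∷ x) = b ∷ false ∷ padVertex x

unpadVertex : ∀ {d} → Vertex (double d) → Vertex d
unpadVertex {zero} [] = []
unpadVertex {suc d} (b ∷ _ ∷ y) = b ∷ unpadVertex y

dim-pad : ∀ {d} (C : Subcube d) → dim (pad C) ≡ d
dim-pad [] = refl
dim-pad (nothing ∷ C) = cong suc (dim-pad C)
dim-pad (just a ∷ C) = cong suc (dim-pad C)

padVertex-∈C : ∀ {d} (C : Subcube d) (x : Vertex d) → x ∈C C → padVertex x ∈C pad C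
padVertex-∈C [] [] h = λ ()
padVertex-∈C (nothing ∷ C) (b ∷ x) h =
  ∈C-∷ (fits-free b) (∈C-∷ (fits-fixed false) (padVertex-∈C C x (∈C-tail x h)))
padVertex-∈C (just a ∷ C) (b ∷ x) h =
  ∈C-∷ (∈C-head h) (∈C-∷ (fits-free false) (padVertex-∈C C x (∈C-tail x h)))

unpadVertex-∈C : ∀ {d} (C : Subcube d) (y : Vertex (double d)) → y ∈C pad C → unpadVertex y ∈C C
unpadVertex-∈C [] [] h = λ ()
unpadVertex-∈C (nothing ∷ C) (b ∷ b′ ∷ y) h =
  ∈C-∷ (fits-free b) (unpadVertex-∈C C y (∈C-tail y (∈C-tail (b′ ∷ y) h)))
unpadVertex-∈C (just a ∷ C) (b ∷ b′ ∷ y) h =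
  ∈C-∷ (∈C-head h) (unpadVertex-∈C C y (∈C-tail y (∈C-tail (b′ ∷ y) h)))

intersect-pad : ∀ {d} (C D : Subcube d) → Intersect C D ⇔ Intersect (pad C) (pad D)
intersect-pad C D = mk⇔
  (λ (x , x∈C , x∈D) → padVertex x , padVertex-∈C C x x∈C , padVertex-∈C D x x∈D)
  (λ (y , y∈C , y∈D) → unpadVertex y , unpadVertex-∈C C y y∈C , unpadVertex-∈C D y y∈D)

isIntersectionRep-pad : ∀ {n d} (G : SimpleGraph n) (f : Fin n → Subcube d) →
                        IsIntersectionRep G f → IsIntersectionRep G (pad ∘ f)
isIntersectionRep-pad G f rep u v u≢v =
  mk⇔ (to (intersect-pad (f u) (f v)) ∘ to (rep u v u≢v))
      (from (rep u v u≢v) ∘ from (intersect-pad (f u) (f v)))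
  where open Equivalence

RhoRep⇒TauRep : ∀ {n d} (G : SimpleGraph n) → RhoRep G d → TauRep G d
RhoRep⇒TauRep {d = d} G (f , rep) =
  double d , pad ∘ f , isIntersectionRep-pad G f rep , dim-pad ∘ f

ρ≤⇒τ≤ : ∀ {n d} (G : SimpleGraph n) → ρ≤ G d → τ≤ G d
ρ≤⇒τ≤ G (d′ , d′≤d , rep) = d′ , d′≤d , RhoRep⇒TauRep G rep

mainTheorem1 : (∀ (n : ℕ) (G : SimpleGraph n) (d : ℕ) → RhoRep G d → τ≤ G d)
    × (∀ (n : ℕ) → 1 ≤ n → ∀ (d : ℕ) → ρn≤ n d → τn≤ n d)
mainTheorem1 =
  (λ n G d rep → d , ≤-refl , RhoRep⇒TauRep G rep) ,
  (λ n _ d ρn≤d G → ρ≤⇒τ≤ G (ρn≤d G))
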